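{- Let $M$ be a binary matroid on a finite set $E$, let $X\subseteq E$, let $e\in E$ and $A\subseteq E$. Suppose $C$ is an OX-circuit of $M$ and $C'$ is an EX-circuit of $M$ such that $e\in C\subseteq A\cup\{e\}$ and $e\in C'\subseteq A\cup\{e\}$. Then there is an OX-circuit $C''$ of $M$ with $C''\subseteq A$.
   Context: An OX-circuit of $M$ is a circuit of $M$ containing an odd number of elements of $X$; an EX-circuit of $M$ is a circuit of $M$ containing an even number of elements of $X$. -}

module Defs where

open import Data.Nat using (ℕ; _%_)
open import Data.Bool using (Bool; true; false; _∧_; _xor_)
open import Data.Fin using (Fin)
open import Data.Fin.Subset using (Subset; _⊆_; _⊂_; _∩_; ∣_∣; Nonempty)
open import Data.Vec using (foldr′; tabulate; lookup)
open import Data.Product using (Σ; _×_)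
open import Relation.Binary.PropositionalEquality using (_≡_)
open import Relation.Nullary using (¬_)

-- A binary matroid on ground set E = Fin n is represented (up to relabelling,
-- which is the definition of binary = GF(2)-representable) by a matrix over
-- GF(2) = Bool with n columns (indexed by E) and r rows.
BinMatrix : ℕ → ℕ → Set
BinMatrix r n = Fin n → Fin r → Bool

colSum : ∀ {r n} → BinMatrix r n → Subset n → Fin r → Bool
colSum mat S i = foldr′ _xor_ false (tabulate (λ j → lookup S j ∧ mat j i))

-- Over GF(2), a set of columns is linearly dependent iff some nonempty
-- subset of it sums to zero (the nonzero coefficients of a dependency).
Dependent : ∀ {r n} → BinMatrix r n → Subset n → Set
Dependent mat S = Σ (Subset _) λ T → T ⊆ S × Nonempty T × (∀ i → colSum mat T i ≡ false)

Circuit : ∀ {r n} → BinMatrix r n → Subset n → Set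
Circuit mat C = Dependent mat C × (∀ D → D ⊂ C → ¬ Dependent mat D)

OXCircuit : ∀ {r n} → BinMatrix r n → Subset n → Subset n → Set
OXCircuit mat X C = Circuit mat C × ∣ C ∩ X ∣ % 2 ≡ 1

EXCircuit : ∀ {r n} → BinMatrix r n → Subset n → Subset n → Set
EXCircuit mat X C = Circuit mat C × ∣ C ∩ X ∣ % 2 ≡ 0

-- C ⊕ C′ is a cycle (its columns sum to zero) that avoids e, lies in A and meets X in an odd
-- number of elements. An odd cycle S contains an OX-circuit: either S is itself a circuit, or it
-- properly contains a nonempty cycle T, and then one of T and S ⊕ T is a smaller odd cycle,
-- because X-parity is additive under ⊕.
module Submission where

open import Defs
open import Algebra using (CommutativeRing)
open import Data.Bool using (Bool; true; false; not; _∧_; _xor_; if_then_else_)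
open import Data.Bool.Properties using (∧-distribʳ-xor; xor-∧-commutativeRing)
  renaming (_≟_ to _≟ᵇ_)
open import Data.Empty using (⊥-elim)
open import Data.Fin using (Fin; zero; suc)
open import Data.Fin.Properties using (all?)
open import Data.Fin.Subset
  using (Subset; inside; outside; _∈_; _∉_; _⊆_; _⊂_; _∪_; _∩_; ⁅_⁆; ∣_∣; Nonempty; ⊥)
open import Data.Fin.Subset.Properties
  using (_∈?_; _⊂?_; nonempty?; anySubset?; Empty-unique; ⊆-refl; ⊆-trans; ⊆-antisym;
         ⊆-⊂-trans; p⊂q⇒p⊆q; p⊂q⇒∣p∣<∣q∣; x∈p∪q⁻; x∈⁅y⁆⇒x≡y)
open import Data.Nat using (ℕ; suc; _%_)
open import Data.Nat.DivMod using (%-distribˡ-+)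
open import Data.Nat.Induction using (<-wellFounded)
open import Data.Product using (Σ; ∃-syntax; _×_; _,_)
import Data.Sum as Sum
open import Data.Sum using (_⊎_; inj₁; inj₂)
open import Data.Vec using ([]; _∷_; zipWith; lookup; here; there)
open import Induction.WellFounded using (WellFounded; Acc; acc; module Subrelation)
import Relation.Binary.Construct.On as On
open import Relation.Binary.PropositionalEquality using (_≡_; refl; sym; trans; cong; cong₂; subst)
open import Relation.Nullary using (¬_; Dec; yes; no; contradiction)
open import Relation.Nullary.Decidable using (_×-dec_)

open import Algebra.Properties.CommutativeSemigroup
  (CommutativeRing.+-commutativeSemigroup xor-∧-commutativeRing) using (interchange)

private
  variable
    r n : ℕ
    x : Fin n
    p q : Subset n

xor-∧-interchange : ∀ a b c s t → ((a xor b) ∧ c) xor (s xor t) ≡ ((a ∧ c) xor s) xor ((b ∧ c) xor t)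
xor-∧-interchange a b c s t =
  trans (cong (_xor (s xor t)) (∧-distribʳ-xor c a b)) (interchange (a ∧ c) (b ∧ c) s t)

infixl 6 _⊕_

_⊕_ : Subset n → Subset n → Subset n
_⊕_ = zipWith _xor_

x∈p⊕q⁻ : ∀ (p q : Subset n) → x ∈ p ⊕ q → x ∈ p ⊎ x ∈ q
x∈p⊕q⁻ (inside  ∷ p) (outside ∷ q) here = inj₁ here
x∈p⊕q⁻ (outside ∷ p) (inside  ∷ q) here = inj₂ here
x∈p⊕q⁻ (_ ∷ p) (_ ∷ q) (there x∈p⊕q) = Sum.map there there (x∈p⊕q⁻ p q x∈p⊕q)

x∈p∩q⇒x∉p⊕q : x ∈ p → x ∈ q → x ∉ p ⊕ q
x∈p∩q⇒x∉p⊕q here here = λ ()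
x∈p∩q⇒x∉p⊕q (there x∈p) (there x∈q) (there x∈p⊕q) = x∈p∩q⇒x∉p⊕q x∈p x∈q x∈p⊕q

p⊕q⊂p : ∀ {p q : Subset n} → q ⊆ p → Nonempty q → p ⊕ q ⊂ p
p⊕q⊂p {p = p} {q = q} q⊆p (y , y∈q) = p⊕q⊆p , y , q⊆p y∈q , x∈p∩q⇒x∉p⊕q (q⊆p y∈q) y∈q
  where
  p⊕q⊆p : p ⊕ q ⊆ p
  p⊕q⊆p x∈p⊕q with x∈p⊕q⁻ p q x∈p⊕q
  ... | inj₁ x∈p = x∈p
  ... | inj₂ x∈q = q⊆p x∈q

p⊕q⊆r : ∀ {p q r : Subset n} {y} → y ∈ p → y ∈ q → p ⊆ r ∪ ⁅ y ⁆ → q ⊆ r ∪ ⁅ y ⁆ → p ⊕ q ⊆ r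
p⊕q⊆r {p = p} {q} {r} {y} y∈p y∈q p⊆ q⊆ x∈p⊕q
  with x∈p∪q⁻ r ⁅ y ⁆ (Sum.[ p⊆ , q⊆ ] (x∈p⊕q⁻ p q x∈p⊕q))
... | inj₁ x∈r = x∈r
... | inj₂ x∈y with refl ← x∈⁅y⁆⇒x≡y y x∈y = contradiction x∈p⊕q (x∈p∩q⇒x∉p⊕q y∈p y∈q)

⊂-wellFounded : WellFounded (_⊂_ {n})
⊂-wellFounded = Subrelation.wellFounded p⊂q⇒∣p∣<∣q∣ (On.wellFounded ∣_∣ <-wellFounded)

colSum-⊕ : ∀ (mat : BinMatrix r n) S T i →
  colSum mat (S ⊕ T) i ≡ colSum mat S i xor colSum mat T i
colSum-⊕ mat [] [] i = refl
colSum-⊕ mat (a ∷ S) (b ∷ T) i =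
  trans (cong (((a xor b) ∧ mat zero i) xor_) (colSum-⊕ (λ j → mat (suc j)) S T i))
        (xor-∧-interchange a b (mat zero i) _ _)

colSum-⊥ : ∀ (mat : BinMatrix r n) i → colSum mat ⊥ i ≡ false
colSum-⊥ {n = 0}     mat i = refl
colSum-⊥ {n = suc n} mat i = colSum-⊥ (λ j → mat (suc j)) i

colSum≡true⇒Nonempty : ∀ (mat : BinMatrix r n) S i → colSum mat S i ≡ true → Nonempty S
colSum≡true⇒Nonempty mat S i sum≡true with nonempty? S
... | yes ne = ne
... | no empty with refl ← Empty-unique empty with trans (sym sum≡true) (colSum-⊥ mat i)
...   | ()

indicatorRow : Subset n → BinMatrix 1 n
indicatorRow X j _ = lookup X j

-- X-parity is linear over GF(2): it is the column sum in the one-row matrix marking X.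
parityIn : Subset n → Subset n → Bool
parityIn X S = colSum (indicatorRow X) S zero

bit : Bool → ℕ
bit b = if b then 1 else 0

%2-suc : ∀ m b → m % 2 ≡ bit b → suc m % 2 ≡ bit (not b)
%2-suc m false m%2 = trans (%-distribˡ-+ 1 m 2) (cong (λ k → suc k % 2) m%2)
%2-suc m true  m%2 = trans (%-distribˡ-+ 1 m 2) (cong (λ k → suc k % 2) m%2)

∣∩∣%2≡parityIn : ∀ (X S : Subset n) → ∣ S ∩ X ∣ % 2 ≡ bit (parityIn X S)
∣∩∣%2≡parityIn []      []            = refl
∣∩∣%2≡parityIn (x ∷ X) (outside ∷ S) = ∣∩∣%2≡parityIn X S
∣∩∣%2≡parityIn (outside ∷ X) (inside ∷ S) = ∣∩∣%2≡parityIn X S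
∣∩∣%2≡parityIn (inside ∷ X) (inside ∷ S) = %2-suc ∣ S ∩ X ∣ (parityIn X S) (∣∩∣%2≡parityIn X S)

odd⇒parityIn≡true : ∀ (X S : Subset n) → ∣ S ∩ X ∣ % 2 ≡ 1 → parityIn X S ≡ true
odd⇒parityIn≡true X S odd with parityIn X S | trans (sym (∣∩∣%2≡parityIn X S)) odd
... | true  | _ = refl
... | false | ()

even⇒parityIn≡false : ∀ (X S : Subset n) → ∣ S ∩ X ∣ % 2 ≡ 0 → parityIn X S ≡ false
even⇒parityIn≡false X S even with parityIn X S | trans (sym (∣∩∣%2≡parityIn X S)) even
... | false | _ = refl
... | true  | ()

module _ (mat : BinMatrix r n) where

  Cycle : Subset n → Set
  Cycle S = ∀ i → colSum mat S i ≡ false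

  cycle? : (S : Subset n) → Dec (Cycle S)
  cycle? S = all? (λ i → colSum mat S i ≟ᵇ false)

  cycle-⊕ : ∀ S T → Cycle S → Cycle T → Cycle (S ⊕ T)
  cycle-⊕ S T cycS cycT i = trans (colSum-⊕ mat S T i) (cong₂ _xor_ (cycS i) (cycT i))

  circuit⇒cycle : ∀ {C} → Circuit mat C → Cycle C
  circuit⇒cycle {C} ((T , T⊆C , neT , cycT) , minimal) with T ⊂? C
  ... | yes T⊂C = ⊥-elim (minimal T T⊂C (T , ⊆-refl , neT , cycT))
  ... | no  T⊄C = subst Cycle (⊆-antisym T⊆C C⊆T) cycT
    where
    C⊆T : C ⊆ T
    C⊆T {x} x∈C with x ∈? T
    ... | yes x∈T = x∈T
    ... | no  x∉T = ⊥-elim (T⊄C (T⊆C , x , x∈C , x∉T))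

  circuit⊎properSubcycle : ∀ {S} → Nonempty S → Cycle S →
    Circuit mat S ⊎ ∃[ T ] (T ⊂ S × Nonempty T × Cycle T)
  circuit⊎properSubcycle {S} neS cycS
    with anySubset? (λ T → (T ⊂? S) ×-dec (nonempty? T ×-dec cycle? T))
  ... | yes subcycle = inj₂ subcycle
  ... | no  none     = inj₁ ((S , ⊆-refl , neS , cycS) , minimal)
    where
    minimal : ∀ D → D ⊂ S → ¬ Dependent mat D
    minimal D D⊂S (T , T⊆D , neT , cycT) = none (T , ⊆-⊂-trans T⊆D D⊂S , neT , cycT)

  oddCycle⇒OXCircuit : ∀ X S → Cycle S → parityIn X S ≡ true →
    Σ (Subset n) λ C → OXCircuit mat X C × C ⊆ S
  oddCycle⇒OXCircuit X S = go S (⊂-wellFounded S)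
    where
    shrink : ∀ {S T} → T ⊆ S → Σ (Subset n) (λ C → OXCircuit mat X C × C ⊆ T) →
      Σ (Subset n) λ C → OXCircuit mat X C × C ⊆ S
    shrink T⊆S (C , ox , C⊆T) = C , ox , ⊆-trans C⊆T T⊆S

    go : ∀ S → Acc _⊂_ S → Cycle S → parityIn X S ≡ true →
      Σ (Subset n) λ C → OXCircuit mat X C × C ⊆ S
    go S (acc smaller) cycS oddS
      with circuit⊎properSubcycle (colSum≡true⇒Nonempty (indicatorRow X) S zero oddS) cycS
    ... | inj₁ circuit = S , (circuit , trans (∣∩∣%2≡parityIn X S) (cong bit oddS)) , ⊆-refl
    ... | inj₂ (T , T⊂S , neT , cycT) with parityIn X T in parityT
    ...   | true  = shrink (p⊂q⇒p⊆q T⊂S) (go T (smaller T⊂S) cycT parityT)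
    ...   | false =
      shrink (p⊂q⇒p⊆q S⊕T⊂S) (go (S ⊕ T) (smaller S⊕T⊂S) (cycle-⊕ S T cycS cycT) oddS⊕T)
      where
      S⊕T⊂S : S ⊕ T ⊂ S
      S⊕T⊂S = p⊕q⊂p (p⊂q⇒p⊆q T⊂S) neT

      oddS⊕T : parityIn X (S ⊕ T) ≡ true
      oddS⊕T = trans (colSum-⊕ (indicatorRow X) S T zero) (cong₂ _xor_ oddS parityT)

proposition2p6 : (r n : ℕ) (mat : BinMatrix r n) (X A : Subset n) (e : Fin n)
    (C C′ : Subset n) →
    OXCircuit mat X C → EXCircuit mat X C′ →
    e ∈ C → C ⊆ A ∪ ⁅ e ⁆ → e ∈ C′ → C′ ⊆ A ∪ ⁅ e ⁆ →
    Σ (Subset n) λ C″ → OXCircuit mat X C″ × C″ ⊆ A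
proposition2p6 r n mat X A e C C′ (circC , oddC) (circC′ , evenC′) e∈C C⊆ e∈C′ C′⊆ =
  let (D , oxD , D⊆C⊕C′) = oddCycle⇒OXCircuit mat X (C ⊕ C′) cycle odd
  in D , oxD , ⊆-trans D⊆C⊕C′ (p⊕q⊆r e∈C e∈C′ C⊆ C′⊆)
  where
  cycle : Cycle mat (C ⊕ C′)
  cycle = cycle-⊕ mat C C′ (circuit⇒cycle mat circC) (circuit⇒cycle mat circC′)

  odd : parityIn X (C ⊕ C′) ≡ true
  odd = trans (colSum-⊕ (indicatorRow X) C C′ zero)
              (cong₂ _xor_ (odd⇒parityIn≡true X C oddC) (even⇒parityIn≡false X C′ evenC′))
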